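{- Let $(\mathscr{L},\vdash)$ be a logical structure. Then the following statements are equivalent. (1) $(\mathscr{L},\vdash)$ is of Tarski-type. (2) There exists a Suszko set for $(\mathscr{L},\vdash)$. (3) For all $\Gamma\cup\{\alpha\}\subseteq\mathscr{L}$ with $\Gamma\nvdash\alpha$, there exists a strongly closed set $\Sigma\supseteq\Gamma$ such that $\Sigma\nvdash\alpha$. (4) For all $\Gamma,\Sigma\subseteq\mathscr{L}$, $\Sigma\subseteq C_{\vdash}(\Gamma)$ if and only if $C_{\vdash}(\Sigma)\subseteq C_{\vdash}(\Gamma)$.
   Context: A logical structure is a pair $(\mathscr{L},\vdash)$ where $\mathscr{L}$ is a nonempty set and $\vdash\subseteq\mathcal{P}(\mathscr{L})\times\mathscr{L}$ is nonempty; write $\Gamma\vdash\alpha$ for $(\Gamma,\alpha)\in\vdash$ and $\Gamma\nvdash\alpha$ otherwise. For $\Gamma\subseteq\mathscr{L}$, $C_\vdash(\Gamma)=\{\alpha\in\mathscr{L}:\Gamma\vdash\alpha\}$. $(\mathscr{L},\vdash)$ is of Tarski-type if it is reflexive ($\alpha\in\Gamma$ implies $\Gamma\vdash\alpha$), monotone ($\Gamma\vdash\alpha$ and $\Gamma\subseteq\Sigma$ imply $\Sigma\vdash\alpha$) and transitive (if $\Gamma\vdash\beta$ for all $\beta\in\Sigma$ and $\Sigma\vdash\alpha$, then $\Gamma\vdash\alpha$). A set $\Gamma\subseteq\mathscr{L}$ is strongly closed if (i) $\Gamma\vdash\alpha$ for every $\alpha\in\Gamma$, and (ii) for every $\alpha\in\mathscr{L}$,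 if there is $\Gamma'\subseteq\Gamma$ with $\Gamma'\vdash\alpha$, then $\alpha\in\Gamma$. A bivaluation is a function $v:\mathscr{L}\to\{0,1\}$; it satisfies $\Gamma$ if $v(\alpha)=1$ for all $\alpha\in\Gamma$. For a set $\mathcal{V}$ of bivaluations, $\Gamma\vdash_{\mathcal{V}}\alpha$ iff every $v\in\mathcal{V}$ satisfying $\Gamma$ has $v(\alpha)=1$. A Suszko set for $(\mathscr{L},\vdash)$ is a nonempty set $\mathcal{V}$ of bivaluations with $\vdash\,=\,\vdash_{\mathcal{V}}$. -}

module Defs where

open import Data.Bool using (Bool; true; false)
open import Data.Product using (Σ; ∃; _×_; _,_)
open import Relation.Binary.PropositionalEquality using (_≡_)
open import Relation.Nullary using (¬_)
open import Level using (Level; suc; zero)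

Subset : Set → Set
Subset L = L → Bool

_∈_ : {L : Set} → L → Subset L → Set
α ∈ Γ = Γ α ≡ true

_⊆_ : {L : Set} → Subset L → Subset L → Set
Γ ⊆ Σ' = ∀ α → α ∈ Γ → α ∈ Σ'

record LogicalStructure : Set₁ where
  field
    Fm       : Set
    _⊢ᵇ_     : Subset Fm → Fm → Bool
    Fm-inhabited : Fm
    ⊢-nonempty   : Σ (Subset Fm) λ Γ → Σ Fm λ α → _⊢ᵇ_ Γ α ≡ true

module _ (S : LogicalStructure) where
  open LogicalStructure S

  infix 4 _⊢_ _⊬_
  _⊢_ : Subset Fm → Fm → Set
  Γ ⊢ α = Γ ⊢ᵇ α ≡ true

  _⊬_ : Subset Fm → Fm → Set
  Γ ⊬ α = ¬ (Γ ⊢ α)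

  C : Subset Fm → Subset Fm
  C Γ = λ α → Γ ⊢ᵇ α

  Reflexive : Set
  Reflexive = ∀ (Γ : Subset Fm) α → α ∈ Γ → Γ ⊢ α

  Monotone : Set
  Monotone = ∀ (Γ Σ' : Subset Fm) α → Γ ⊢ α → Γ ⊆ Σ' → Σ' ⊢ α

  Transitive : Set
  Transitive = ∀ (Γ Σ' : Subset Fm) α → (∀ β → β ∈ Σ' → Γ ⊢ β) → Σ' ⊢ α → Γ ⊢ α

  TarskiType : Set
  TarskiType = Reflexive × Monotone × Transitive

  StronglyClosed : Subset Fm → Set
  StronglyClosed Γ =
    (∀ α → α ∈ Γ → Γ ⊢ α) ×
    (∀ α → (Σ (Subset Fm) λ Γ' → Γ' ⊆ Γ × Γ' ⊢ α) → α ∈ Γ)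

  Bivaluation : Set
  Bivaluation = Fm → Bool

  Satisfies : Bivaluation → Subset Fm → Set
  Satisfies v Γ = ∀ α → α ∈ Γ → v α ≡ true

  BivaluationSet : Set₁
  BivaluationSet = Bivaluation → Set

  _⊢[_]_ : Subset Fm → BivaluationSet → Fm → Set
  Γ ⊢[ 𝒱 ] α = ∀ v → 𝒱 v → Satisfies v Γ → v α ≡ true

  SuszkoSet : BivaluationSet → Set
  SuszkoSet 𝒱 = (Σ Bivaluation 𝒱) ×
    (∀ Γ α → (Γ ⊢ α → Γ ⊢[ 𝒱 ] α) × (Γ ⊢[ 𝒱 ] α → Γ ⊢ α))

  ExistsSuszkoSet : Set₁
  ExistsSuszkoSet = Σ BivaluationSet SuszkoSet

  Condition3 : Set
  Condition3 = ∀ (Γ : Subset Fm) α → Γ ⊬ α →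
    Σ (Subset Fm) λ Σ' → StronglyClosed Σ' × Γ ⊆ Σ' × Σ' ⊬ α

  Condition4 : Set
  Condition4 = ∀ (Γ Σ' : Subset Fm) → (Σ' ⊆ C Γ → C Σ' ⊆ C Γ) × (C Σ' ⊆ C Γ → Σ' ⊆ C Γ)

{-# OPTIONS --safe #-}
-- Under reflexivity and transitivity the closure C Γ does all the work: it is
-- strongly closed, contains Γ and proves exactly what Γ proves, and as a
-- bivaluation it respects ⊢, so the bivaluations respecting ⊢ form a Suszko set.
-- Conversely every relation ⊢_𝒱 is Tarskian; under (3), Γ ⊢ α as soon as α lies
-- in every strongly closed extension of Γ, and there ⊢ is just membership, so the
-- Tarski properties are checked on those extensions.
module Submission where

open import Data.Bool using (true)
open import Data.Bool.Properties using () renaming (_≟_ to _≟ᵇ_)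
open import Data.Product using (_×_; _,_; proj₁; proj₂)
open import Function.Bundles using (_⇔_; mk⇔)
open import Relation.Binary.PropositionalEquality using (_≡_; refl)
open import Relation.Nullary using (¬_)
open import Relation.Nullary.Decidable using (decidable-stable)
open import Defs hiding (_⊢_; _⊬_; _⊢[_]_)
import Defs

⊆-refl : {L : Set} {Γ : Subset L} → Γ ⊆ Γ
⊆-refl _ α∈Γ = α∈Γ

⊆-trans : {L : Set} {Γ Δ Θ : Subset L} → Γ ⊆ Δ → Δ ⊆ Θ → Γ ⊆ Θ
⊆-trans Γ⊆Δ Δ⊆Θ α α∈Γ = Δ⊆Θ α (Γ⊆Δ α α∈Γ)

module _ (S : LogicalStructure) where
  open LogicalStructure S

  infix 4 _⊢_ _⊬_ _⊢[_]_

  _⊢_ : Subset Fm → Fm → Set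
  _⊢_ = Defs._⊢_ S

  _⊬_ : Subset Fm → Fm → Set
  _⊬_ = Defs._⊬_ S

  _⊢[_]_ : Subset Fm → BivaluationSet S → Fm → Set
  _⊢[_]_ = Defs._⊢[_]_ S

  -- (3) ⇒ (1) argues by contradiction; this is constructive because ⊢ is Bool-valued.
  ⊢-stable : ∀ {Γ α} → ¬ Γ ⊬ α → Γ ⊢ α
  ⊢-stable {Γ} {α} = decidable-stable (Γ ⊢ᵇ α ≟ᵇ true)

  ⊢[]-reflexive : ∀ 𝒱 Γ α → α ∈ Γ → Γ ⊢[ 𝒱 ] α
  ⊢[]-reflexive 𝒱 Γ α α∈Γ v _ v⊨Γ = v⊨Γ α α∈Γ

  ⊢[]-monotone : ∀ 𝒱 Γ Δ α → Γ ⊢[ 𝒱 ] α → Γ ⊆ Δ → Δ ⊢[ 𝒱 ] α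
  ⊢[]-monotone 𝒱 Γ Δ α Γ⊢α Γ⊆Δ v v∈𝒱 v⊨Δ = Γ⊢α v v∈𝒱 (⊆-trans Γ⊆Δ v⊨Δ)

  ⊢[]-transitive : ∀ 𝒱 Γ Δ α → (∀ β → β ∈ Δ → Γ ⊢[ 𝒱 ] β) → Δ ⊢[ 𝒱 ] α → Γ ⊢[ 𝒱 ] α
  ⊢[]-transitive 𝒱 Γ Δ α Γ⊢Δ Δ⊢α v v∈𝒱 v⊨Γ = Δ⊢α v v∈𝒱 (λ β β∈Δ → Γ⊢Δ β β∈Δ v v∈𝒱 v⊨Γ)

  C-inflationary : Reflexive S → ∀ Γ → Γ ⊆ C S Γ
  C-inflationary reflexive Γ = reflexive Γ

  C-⊢⇒⊢ : Transitive S → ∀ {Γ α} → C S Γ ⊢ α → Γ ⊢ α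
  C-⊢⇒⊢ transitive {Γ} {α} = transitive Γ (C S Γ) α ⊆-refl

  C-stronglyClosed : Reflexive S → Transitive S → ∀ Γ → StronglyClosed S (C S Γ)
  C-stronglyClosed reflexive transitive Γ =
    (λ α α∈CΓ → reflexive (C S Γ) α α∈CΓ) ,
    (λ { α (Γ′ , Γ′⊆CΓ , Γ′⊢α) → transitive Γ Γ′ α Γ′⊆CΓ Γ′⊢α })

  stronglyClosed-absorbs : ∀ {Θ Γ α} → StronglyClosed S Θ → Γ ⊆ Θ → Γ ⊢ α → α ∈ Θ
  stronglyClosed-absorbs {Γ = Γ} (_ , absorbs) Γ⊆Θ Γ⊢α = absorbs _ (Γ , Γ⊆Θ , Γ⊢α)

  RespectsConsequence : Bivaluation S → Set
  RespectsConsequence v = ∀ Δ β → Satisfies S v Δ → Δ ⊢ β → v β ≡ true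

  C-respectsConsequence : Transitive S → ∀ Γ → RespectsConsequence (C S Γ)
  C-respectsConsequence transitive Γ = transitive Γ

  respectsConsequence-suszko : Reflexive S → Transitive S → SuszkoSet S RespectsConsequence
  respectsConsequence-suszko reflexive transitive =
    ((λ _ → true) , λ _ _ _ _ → refl) ,
    λ Γ α → (λ Γ⊢α v v-respects v⊨Γ → v-respects Γ α v⊨Γ Γ⊢α) ,
            (λ Γ⊨α → Γ⊨α (C S Γ) (C-respectsConsequence transitive Γ) (C-inflationary reflexive Γ))

  tarski⇒suszko : TarskiType S → ExistsSuszkoSet S
  tarski⇒suszko (reflexive , _ , transitive) =
    RespectsConsequence , respectsConsequence-suszko reflexive transitive

  suszko⇒tarski : ExistsSuszkoSet S → TarskiType S
  suszko⇒tarski (𝒱 , _ , ⊢⇔⊢[𝒱]) = reflexive , monotone , transitive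
    where
      sound : ∀ {Γ α} → Γ ⊢ α → Γ ⊢[ 𝒱 ] α
      sound = proj₁ (⊢⇔⊢[𝒱] _ _)

      complete : ∀ {Γ α} → Γ ⊢[ 𝒱 ] α → Γ ⊢ α
      complete = proj₂ (⊢⇔⊢[𝒱] _ _)

      reflexive : Reflexive S
      reflexive Γ α α∈Γ = complete (⊢[]-reflexive 𝒱 Γ α α∈Γ)

      monotone : Monotone S
      monotone Γ Δ α Γ⊢α Γ⊆Δ = complete (⊢[]-monotone 𝒱 Γ Δ α (sound Γ⊢α) Γ⊆Δ)

      transitive : Transitive S
      transitive Γ Δ α Γ⊢Δ Δ⊢α =
        complete (⊢[]-transitive 𝒱 Γ Δ α (λ β β∈Δ → sound (Γ⊢Δ β β∈Δ)) (sound Δ⊢α))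

  tarski⇒condition3 : TarskiType S → Condition3 S
  tarski⇒condition3 (reflexive , _ , transitive) Γ α Γ⊬α =
    C S Γ , C-stronglyClosed reflexive transitive Γ , C-inflationary reflexive Γ ,
    λ CΓ⊢α → Γ⊬α (C-⊢⇒⊢ transitive CΓ⊢α)

  condition3⇒⊢ : Condition3 S → ∀ {Γ α} →
    (∀ Θ → StronglyClosed S Θ → Γ ⊆ Θ → α ∈ Θ) → Γ ⊢ α
  condition3⇒⊢ condition3 {Γ} {α} α∈extensions = ⊢-stable λ Γ⊬α →
    let (Θ , Θ-closed , Γ⊆Θ , Θ⊬α) = condition3 Γ α Γ⊬α
    in Θ⊬α (proj₁ Θ-closed α (α∈extensions Θ Θ-closed Γ⊆Θ))

  condition3⇒tarski : Condition3 S → TarskiType S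
  condition3⇒tarski condition3 = reflexive , monotone , transitive
    where
      reflexive : Reflexive S
      reflexive Γ α α∈Γ = condition3⇒⊢ condition3 λ _ _ Γ⊆Θ → Γ⊆Θ α α∈Γ

      monotone : Monotone S
      monotone Γ Δ α Γ⊢α Γ⊆Δ = condition3⇒⊢ condition3 λ _ Θ-closed Δ⊆Θ →
        stronglyClosed-absorbs Θ-closed (⊆-trans Γ⊆Δ Δ⊆Θ) Γ⊢α

      transitive : Transitive S
      transitive Γ Δ α Γ⊢Δ Δ⊢α = condition3⇒⊢ condition3 λ _ Θ-closed Γ⊆Θ →
        stronglyClosed-absorbs Θ-closed
          (λ β β∈Δ → stronglyClosed-absorbs Θ-closed Γ⊆Θ (Γ⊢Δ β β∈Δ)) Δ⊢α

  tarski⇒condition4 : TarskiType S → Condition4 S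
  tarski⇒condition4 (reflexive , _ , transitive) Γ Δ =
    (λ Δ⊆CΓ α → transitive Γ Δ α Δ⊆CΓ) ,
    (λ CΔ⊆CΓ → ⊆-trans (C-inflationary reflexive Δ) CΔ⊆CΓ)

  condition4⇒tarski : Condition4 S → TarskiType S
  condition4⇒tarski condition4 = reflexive , monotone , transitive
    where
      reflexive : Reflexive S
      reflexive Γ = proj₂ (condition4 Γ Γ) ⊆-refl

      transitive : Transitive S
      transitive Γ Δ α Δ⊆CΓ = proj₁ (condition4 Γ Δ) Δ⊆CΓ α

      monotone : Monotone S
      monotone Γ Δ α Γ⊢α Γ⊆Δ = proj₁ (condition4 Δ Γ) (⊆-trans Γ⊆Δ (reflexive Δ)) α Γ⊢α

mainTheorem1 : (S : LogicalStructure) →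
    (TarskiType S ⇔ ExistsSuszkoSet S) × (TarskiType S ⇔ Condition3 S) × (TarskiType S ⇔ Condition4 S)
mainTheorem1 S =
  mk⇔ (tarski⇒suszko S) (suszko⇒tarski S) ,
  mk⇔ (tarski⇒condition3 S) (condition3⇒tarski S) ,
  mk⇔ (tarski⇒condition4 S) (condition4⇒tarski S)
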